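{- Let $G$ be a $4$-regular circulant graph. Then each connected component of $G$ is either wheel-free, or isomorphic to $K_5$, or isomorphic to $\Sigma C_4$.
   Context: For $n \ge 3$ and $S \subseteq \{1,2,\dots,\lfloor n/2 \rfloor\}$, the circulant graph $C_n(S)$ has vertex set $\{0,1,\dots,n-1\}$, with $x \sim y$ iff $x - y \pmod n \in S \cup (-S)$, where $-S = \{n - a : a \in S\}$; it is $|S \cup (-S)|$-regular, and a $4$-regular circulant graph is one with $|S \cup (-S)| = 4$. For $n \ge 3$, the wheel $W_n$ is the cycle $C_n$ together with an extra vertex adjacent to all its vertices; a graph is wheel-free if it contains no subgraph (not necessarily induced) isomorphic to any $W_n$, $n\ge 3$. $\Sigma C_4$ is the graph obtained from the $4$-cycle $C_4$ by adding two new non-adjacent vertices $a,b$, each adjacent to all four vertices of $C_4$. -}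

module Defs where

open import Data.Nat using (ℕ; zero; suc; _+_; _∸_; _≤_; _<_; _/_; _%_; _≡ᵇ_; _≤ᵇ_)
open import Data.Bool using (Bool; T; _∨_; if_then_else_)
open import Data.Fin using (Fin; toℕ)
import Data.Fin as F
open import Data.Unit using (⊤)
open import Data.Fin.Subset using (Subset; ∣_∣)
open import Data.List using (List)
open import Data.Bool.ListAction using (any)
open import Data.List.Relation.Unary.All using (All)
open import Data.Vec using (tabulate)
open import Data.Product using (Σ; _×_; ∃)
open import Data.Sum using (_⊎_)
open import Data.Empty using (⊥)
open import Relation.Nullary using (¬_)
open import Relation.Binary.PropositionalEquality using (_≡_; _≢_)
open import Function.Definitions using (Injective)

Graph : Set → Set₁
Graph V = V → V → Set

ValidConnSet : ℕ → List ℕ → Set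
ValidConnSet n S = All (λ a → 1 ≤ a × a ≤ n / 2) S

inConn : ℕ → List ℕ → ℕ → Bool
inConn n S d = any (λ a → (a ≡ᵇ d) ∨ ((n ∸ a) ≡ᵇ d)) S

diffMod : (n : ℕ) → Fin n → Fin n → ℕ
diffMod n x y = if toℕ y ≤ᵇ toℕ x then toℕ x ∸ toℕ y else (n + toℕ x) ∸ toℕ y

Circulant : (n : ℕ) → List ℕ → Graph (Fin n)
Circulant n S x y = T (inConn n S (diffMod n x y))

connSize : (n : ℕ) → List ℕ → ℕ
connSize n S = ∣ tabulate {n = n} (λ d → inConn n S (toℕ d)) ∣

data Reachable {V : Set} (G : Graph V) : V → V → Set where
  here  : ∀ {v} → Reachable G v v
  step  : ∀ {u v w} → G u v → Reachable G v w → Reachable G u w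

CycleSucc : (m : ℕ) → ℕ → ℕ → Set
CycleSucc m i j = (j ≡ suc i) ⊎ ((suc i ≡ m) × (j ≡ 0))

Cycle : (m : ℕ) → Graph (Fin m)
Cycle m i j = CycleSucc m (toℕ i) (toℕ j) ⊎ CycleSucc m (toℕ j) (toℕ i)

Wheel : (m : ℕ) → Graph (Fin (suc m))
Wheel m F.zero    F.zero    = ⊥
Wheel m F.zero    (F.suc j) = ⊤
Wheel m (F.suc i) F.zero    = ⊤
Wheel m (F.suc i) (F.suc j) = Cycle m i j

K5 : Graph (Fin 5)
K5 x y = x ≢ y

-- ΣC4 on Fin 6: vertices 0,1,2,3 form the 4-cycle (0-1-2-3-0); vertices 4 and 5
-- are the two extra non-adjacent vertices, each adjacent to all of 0,1,2,3.
SigmaC4 : Graph (Fin 6)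
SigmaC4 x y =
  (toℕ x < 4 × toℕ y < 4 × (CycleSucc 4 (toℕ x) (toℕ y) ⊎ CycleSucc 4 (toℕ y) (toℕ x)))
  ⊎ (toℕ x < 4 × 4 ≤ toℕ y)
  ⊎ (4 ≤ toℕ x × toℕ y < 4)

-- The component of G containing v has a (not necessarily induced) subgraph
-- isomorphic to H: an injective, adjacency-preserving map from H into that component.
SubgraphInComponent : {V W : Set} → Graph V → V → Graph W → Set
SubgraphInComponent {V} {W} G v H =
  Σ (W → V) λ f → Injective _≡_ _≡_ f
    × (∀ x y → H x y → G (f x) (f y))
    × (∀ x → Reachable G v (f x))

ComponentWheelFree : {V : Set} → Graph V → V → Set
ComponentWheelFree G v = ∀ m → 3 ≤ m → ¬ SubgraphInComponent G v (Wheel m)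

ComponentIso : {V W : Set} → Graph V → V → Graph W → Set
ComponentIso {V} {W} G v H =
  Σ (W → V) λ f → Injective _≡_ _≡_ f
    × (∀ x → Reachable G v (f x))
    × (∀ u → Reachable G v u → ∃ λ x → f x ≡ u)
    × (∀ x y → H x y → G (f x) (f y))
    × (∀ x y → G (f x) (f y) → H x y)

module Submission where

-- Since |S ∪ −S| = 4, the connection set is {a, b} with 0 < a < b and 2b < n, so the neighbours
-- of x are x ± a and x ± b. In a wheel with hub h every rim vertex is h + g for a generator
-- g ∈ {±a, ±b}, distinct rim vertices giving distinct generators, and a rim edge between h + g
-- and h + g′ makes g′ − g a generator as well, which is a linear relation between n, a and b.
-- Every rim vertex has two rim neighbours and any three generators include one of ±a and one
-- of ±b, so up to sign both a and b take part in two such relations; these force b = 2a and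
-- n ∈ {5a, 6a}. Then the component of v is the coset v + aℤₙ of n/a vertices, on which the
-- graph is C_{n/a}(1, 2), that is K₅ or ΣC₄.

open import Defs
open import Data.Bool using (Bool; true; false; T; _∨_)
open import Data.Bool.Properties using (T-≡; T-∨)
open import Data.Nat
open import Data.Nat.Properties
open import Data.Nat.DivMod
open import Data.Fin as Fin using (Fin; toℕ; #_; zero; suc; fromℕ; fromℕ<; inject₁)
import Data.Fin.Properties as Finₚ
open import Data.Fin.Properties using (all?; toℕ<n; toℕ-injective; toℕ-fromℕ; toℕ-fromℕ<; toℕ-inject₁)
open import Data.Fin.Subset using (∣_∣)
open import Data.List using (List; []; _∷_; length; map; lookup)
open import Data.List.Properties using (length-map)
open import Data.List.Membership.Propositional using (_∈_; find; lose)
open import Data.List.Relation.Unary.Any as Any using (Any; here; there)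
open import Data.List.Relation.Unary.Any.Properties using (any⁺; any⁻)
open import Data.List.Relation.Unary.All as All using (All)
open import Data.List.Relation.Unary.All.Properties using (¬All⇒Any¬)
open import Data.Sum as Sum using (_⊎_; inj₁; inj₂)
open import Data.Empty using (⊥; ⊥-elim)
open import Data.Unit using (tt)
open import Relation.Nullary using (Dec; yes; no)
open import Relation.Nullary.Decidable using (_⊎-dec_; _×-dec_; ¬?; from-yes; T?)
open import Relation.Binary.Definitions using (tri<; tri≈; tri>)
open import Data.Vec using (tabulate)
open import Data.Product using (_×_; _,_; proj₁; proj₂; ∃; ∃₂)
open import Function using (id; _∘_; _⇔_; Equivalence; mk⇔)
open import Relation.Binary.PropositionalEquality
open import Data.Nat.Tactic.RingSolver using (solve-∀; solve)

-- Counting residues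

count : ℕ → (ℕ → Bool) → ℕ
count n p = ∣ tabulate {n = n} (p ∘ toℕ) ∣

positivesPred : List ℕ → List ℕ
positivesPred []           = []
positivesPred (zero ∷ xs)  = positivesPred xs
positivesPred (suc x ∷ xs) = x ∷ positivesPred xs

length-positivesPred : ∀ xs → length (positivesPred xs) ≤ length xs
length-positivesPred []           = z≤n
length-positivesPred (zero ∷ xs)  = m≤n⇒m≤1+n (length-positivesPred xs)
length-positivesPred (suc x ∷ xs) = s≤s (length-positivesPred xs)

length-positivesPred-< : ∀ {xs} → 0 ∈ xs → length (positivesPred xs) < length xs
length-positivesPred-< {zero ∷ xs}  _          = s≤s (length-positivesPred xs)
length-positivesPred-< {suc x ∷ xs} (there 0∈) = s≤s (length-positivesPred-< 0∈)

∈-positivesPred : ∀ {x xs} → suc x ∈ xs → x ∈ positivesPred xs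
∈-positivesPred {xs = zero ∷ xs}  (there x∈)   = ∈-positivesPred x∈
∈-positivesPred {xs = suc y ∷ xs} (here refl)  = here refl
∈-positivesPred {xs = suc y ∷ xs} (there x∈)   = there (∈-positivesPred x∈)

count≤length : ∀ n p xs → (∀ d → d < n → T (p d) → d ∈ xs) → count n p ≤ length xs
count≤length zero    p xs covers = z≤n
count≤length (suc n) p xs covers = extend (count≤length n (p ∘ suc) (positivesPred xs) covers′)
  where
  covers′ : ∀ d → d < n → T (p (suc d)) → d ∈ positivesPred xs
  covers′ d d<n pd = ∈-positivesPred (covers (suc d) (s<s d<n) pd)
  extend : count n (p ∘ suc) ≤ length (positivesPred xs) → count (suc n) p ≤ length xs
  extend ih with p 0 in p0
  ... | true  = ≤-trans (s≤s ih) (length-positivesPred-< (covers 0 z<s (Equivalence.from T-≡ p0)))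
  ... | false = ≤-trans ih (length-positivesPred xs)

count∘suc≤count : ∀ n p → count n (p ∘ suc) ≤ count (suc n) p
count∘suc≤count n p with p 0
... | true  = n≤1+n _
... | false = ≤-refl

data Ascending (n : ℕ) (p : ℕ → Bool) : ℕ → List ℕ → Set where
  []  : ∀ {m} → Ascending n p m []
  _∷_ : ∀ {m x xs} → m ≤ x × x < n × T (p x) → Ascending n p (suc x) xs → Ascending n p m (x ∷ xs)

ascending-pred : ∀ {n p m xs} → Ascending (suc n) p (suc m) xs → Ascending n (p ∘ suc) m (map pred xs)
ascending-pred []                               = []
ascending-pred ((s≤s m≤x , s≤s x<n , px) ∷ xs) = (m≤x , x<n , px) ∷ ascending-pred xs

length≤count : ∀ n p xs → Ascending n p 0 xs → length xs ≤ count n p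
length≤count n       p []       _                      = z≤n
length≤count zero    p (x ∷ xs) ((_ , () , _) ∷ _)
length≤count (suc n) p (zero ∷ xs) ((_ , _ , p0) ∷ asc) with p 0
... | true = s≤s (subst (_≤ count n (p ∘ suc)) (length-map pred xs)
                        (length≤count n (p ∘ suc) _ (ascending-pred asc)))
length≤count (suc n) p (suc x ∷ xs) ((_ , x<n , px) ∷ asc) =
  ≤-trans (subst (_≤ count n (p ∘ suc)) (length-map pred (suc x ∷ xs))
                 (length≤count n (p ∘ suc) _ (ascending-pred ((s≤s z≤n , x<n , px) ∷ asc))))
          (count∘suc≤count n p)

-- Arithmetic modulo n

[m%d+n]%d≡[m+n]%d : ∀ m n d .{{_ : NonZero d}} → (m % d + n) % d ≡ (m + n) % d
[m%d+n]%d≡[m+n]%d m n d = begin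
  (m % d + n) % d         ≡⟨ %-distribˡ-+ (m % d) n d ⟩
  (m % d % d + n % d) % d ≡⟨ cong (λ x → (x + n % d) % d) (m%n%n≡m%n m d) ⟩
  (m % d + n % d) % d     ≡⟨ %-distribˡ-+ m n d ⟨
  (m + n) % d             ∎
  where open ≡-Reasoning

[m+n%d]%d≡[m+n]%d : ∀ m n d .{{_ : NonZero d}} → (m + n % d) % d ≡ (m + n) % d
[m+n%d]%d≡[m+n]%d m n d = begin
  (m + n % d) % d ≡⟨ cong (_% d) (+-comm m (n % d)) ⟩
  (n % d + m) % d ≡⟨ [m%d+n]%d≡[m+n]%d n m d ⟩
  (n + m) % d     ≡⟨ cong (_% d) (+-comm n m) ⟩
  (m + n) % d     ∎
  where open ≡-Reasoning

%-cancelʳ-+ : ∀ m o {k d} .{{_ : NonZero d}} → k ≤ d → (m + k) % d ≡ (o + k) % d → m % d ≡ o % d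
%-cancelʳ-+ m o {k} {d} k≤d eq = begin
  m % d                       ≡⟨ undo m ⟩
  ((m + k) % d + (d ∸ k)) % d ≡⟨ cong (λ x → (x + (d ∸ k)) % d) eq ⟩
  ((o + k) % d + (d ∸ k)) % d ≡⟨ undo o ⟨
  o % d                       ∎
  where
  open ≡-Reasoning
  undo : ∀ x → x % d ≡ ((x + k) % d + (d ∸ k)) % d
  undo x = begin
    x % d                       ≡⟨ [m+n]%n≡m%n x d ⟨
    (x + d) % d                 ≡⟨ cong (λ y → (x + y) % d) (m+[n∸m]≡n k≤d) ⟨
    (x + (k + (d ∸ k))) % d     ≡⟨ cong (_% d) (+-assoc x k (d ∸ k)) ⟨
    (x + k + (d ∸ k)) % d       ≡⟨ [m%d+n]%d≡[m+n]%d (x + k) (d ∸ k) d ⟨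
    ((x + k) % d + (d ∸ k)) % d ∎

%-injective-< : ∀ {m o d} .{{_ : NonZero d}} → m < d → o < d → m % d ≡ o % d → m ≡ o
%-injective-< m<d o<d eq = trans (sym (m<n⇒m%n≡m m<d)) (trans eq (m<n⇒m%n≡m o<d))

%-scale : ∀ c t {d q a} .{{_ : NonZero d}} .{{_ : NonZero q}} → d ≡ q * a →
          (c + t * a) % d ≡ (c + t % q * a) % d
%-scale c t {q = q} {a} refl = begin
  (c + t * a) % (q * a)             ≡⟨ [m+n%d]%d≡[m+n]%d c (t * a) (q * a) ⟨
  (c + t * a % (q * a)) % (q * a)   ≡⟨ cong (λ w → (c + w) % (q * a)) (m%n*o≡m*o%[n*o] t q a) ⟨
  (c + t % q * a) % (q * a)         ∎
  where open ≡-Reasoning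

∸-%-complement : ∀ {n x y z} .{{_ : NonZero n}} → 0 < z → z < n → x ≤ n → y ≤ n →
                 z ≡ (x + y) % n → n ∸ z ≡ (n ∸ x + (n ∸ y)) % n
∸-%-complement {n} {x} {y} {z} 0<z z<n x≤n y≤n eq =
  sym (%-injective-< (m%n<n _ n) (∸-monoʳ-< 0<z (<⇒≤ z<n))
        (%-cancelʳ-+ _ (n ∸ z) (<⇒≤ z<n) (trans sum≡n (sym complement≡n))))
  where
  open ≡-Reasoning
  s : ℕ
  s = n ∸ x + (n ∸ y)
  sum≡n : (s % n + z) % n ≡ n % n
  sum≡n = begin
    (s % n + z) % n                   ≡⟨ [m%d+n]%d≡[m+n]%d s z n ⟩
    (s + z) % n                       ≡⟨ cong (λ w → (s + w) % n) eq ⟩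
    (s + (x + y) % n) % n             ≡⟨ [m+n%d]%d≡[m+n]%d s (x + y) n ⟩
    (n ∸ x + (n ∸ y) + (x + y)) % n   ≡⟨ cong (_% n) (+-comm-middle (n ∸ x) (n ∸ y) x y) ⟩
    (n ∸ x + x + (n ∸ y + y)) % n     ≡⟨ cong₂ (λ u w → (u + w) % n) (m∸n+n≡m x≤n) (m∸n+n≡m y≤n) ⟩
    (n + n) % n                       ≡⟨ [m+n]%n≡m%n n n ⟩
    n % n                             ∎
    where
    +-comm-middle : ∀ p q r t → p + q + (r + t) ≡ p + r + (q + t)
    +-comm-middle = solve-∀
  complement≡n : (n ∸ z + z) % n ≡ n % n
  complement≡n = cong (_% n) (m∸n+n≡m (<⇒≤ z<n))

module _ {n : ℕ} .{{_ : NonZero n}} where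

  diffMod-correct : ∀ (x y : Fin n) → (diffMod n x y + toℕ y) % n ≡ toℕ x
  diffMod-correct x y with toℕ y ≤ᵇ toℕ x in y≤ᵇx
  ... | true  = trans (cong (_% n) (m∸n+n≡m (≤ᵇ⇒≤ (toℕ y) (toℕ x) (Equivalence.from T-≡ y≤ᵇx))))
                      (m<n⇒m%n≡m (toℕ<n x))
  ... | false = begin
    (n + toℕ x ∸ toℕ y + toℕ y) % n ≡⟨ cong (_% n) (m∸n+n≡m (≤-trans (<⇒≤ (toℕ<n y)) (m≤m+n n (toℕ x)))) ⟩
    (n + toℕ x) % n                 ≡⟨ cong (_% n) (+-comm n (toℕ x)) ⟩
    (toℕ x + n) % n                 ≡⟨ [m+n]%n≡m%n (toℕ x) n ⟩
    toℕ x % n                       ≡⟨ m<n⇒m%n≡m (toℕ<n x) ⟩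
    toℕ x                           ∎
    where open ≡-Reasoning

  diffMod<n : ∀ (x y : Fin n) → diffMod n x y < n
  diffMod<n x y with toℕ y ≤ᵇ toℕ x in y≤ᵇx
  ... | true  = ≤-<-trans (m∸n≤m (toℕ x) (toℕ y)) (toℕ<n x)
  ... | false = subst (n + toℕ x ∸ toℕ y <_) (m+n∸n≡m n (toℕ y))
                      (∸-monoˡ-< (+-monoʳ-< n x<y) (≤-trans (<⇒≤ (toℕ<n y)) (m≤m+n n (toℕ x))))
    where
    x<y : toℕ x < toℕ y
    x<y = ≰⇒> (λ y≤x → subst T y≤ᵇx (≤⇒≤ᵇ y≤x))

  diffMod-unique : ∀ (x y : Fin n) {d} → d < n → (d + toℕ y) % n ≡ toℕ x → diffMod n x y ≡ d
  diffMod-unique x y {d} d<n eq = %-injective-< (diffMod<n x y) d<n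
    (%-cancelʳ-+ (diffMod n x y) d (<⇒≤ (toℕ<n y)) (trans (diffMod-correct x y) (sym eq)))

  diffMod-trans : ∀ (x y z : Fin n) → diffMod n x z ≡ (diffMod n x y + diffMod n y z) % n
  diffMod-trans x y z = diffMod-unique x z (m%n<n _ n) (begin
    ((e + f) % n + toℕ z) % n ≡⟨ [m%d+n]%d≡[m+n]%d (e + f) (toℕ z) n ⟩
    (e + f + toℕ z) % n       ≡⟨ cong (_% n) (+-assoc e f (toℕ z)) ⟩
    (e + (f + toℕ z)) % n     ≡⟨ [m+n%d]%d≡[m+n]%d e (f + toℕ z) n ⟨
    (e + (f + toℕ z) % n) % n ≡⟨ cong (λ w → (e + w) % n) (diffMod-correct y z) ⟩
    (e + toℕ y) % n           ≡⟨ diffMod-correct x y ⟩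
    toℕ x                     ∎)
    where
    open ≡-Reasoning
    e f : ℕ
    e = diffMod n x y
    f = diffMod n y z

  diffMod-injectiveˡ : ∀ {x y} (z : Fin n) → diffMod n x z ≡ diffMod n y z → x ≡ y
  diffMod-injectiveˡ {x} {y} z eq = toℕ-injective (begin
    toℕ x                     ≡⟨ diffMod-correct x z ⟨
    (diffMod n x z + toℕ z) % n ≡⟨ cong (λ d → (d + toℕ z) % n) eq ⟩
    (diffMod n y z + toℕ z) % n ≡⟨ diffMod-correct y z ⟩
    toℕ y                     ∎)
    where open ≡-Reasoning

-- The connection set of a 4-regular circulant

inConn⇔ : ∀ {n S d} → T (inConn n S d) ⇔ Any (λ s → s ≡ d ⊎ n ∸ s ≡ d) S
inConn⇔ {n} {S} {d} = mk⇔ (Any.map fromBool ∘ any⁻ _ S) (any⁺ _ ∘ Any.map toBool)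
  where
  fromBool : ∀ {s} → T ((s ≡ᵇ d) ∨ (n ∸ s ≡ᵇ d)) → s ≡ d ⊎ n ∸ s ≡ d
  fromBool = Sum.map (≡ᵇ⇒≡ _ _) (≡ᵇ⇒≡ _ _) ∘ Equivalence.to T-∨
  toBool : ∀ {s} → s ≡ d ⊎ n ∸ s ≡ d → T ((s ≡ᵇ d) ∨ (n ∸ s ≡ᵇ d))
  toBool = Equivalence.from T-∨ ∘ Sum.map (≡⇒≡ᵇ _ _) (≡⇒≡ᵇ _ _)

record TwoGenerators (n : ℕ) (S : List ℕ) : Set where
  field
    a b   : ℕ
    0<a   : 0 < a
    a<b   : a < b
    b+b<n : b + b < n
    a∈S   : a ∈ S
    b∈S   : b ∈ S
    S⊆ab  : ∀ {s} → s ∈ S → s ≡ a ⊎ s ≡ b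

module _ {n S} (valid : ValidConnSet n S) (size : connSize n S ≡ 4) where

  private
    Residue : ℕ → Set
    Residue = T ∘ inConn n S

    member-bounds : ∀ {s} → s ∈ S → 0 < s × s + s ≤ n
    member-bounds {s} s∈S with All.lookup valid s∈S
    ... | 0<s , s≤n/2 = 0<s , (begin
      s + s         ≤⟨ +-mono-≤ s≤n/2 s≤n/2 ⟩
      n / 2 + n / 2 ≡⟨ cong (n / 2 +_) (+-identityʳ (n / 2)) ⟨
      2 * (n / 2)   ≡⟨ *-comm 2 (n / 2) ⟩
      n / 2 * 2     ≤⟨ m/n*n≤m n 2 ⟩
      n             ∎)
      where open ≤-Reasoning

    member-residue : ∀ {s} → s ∈ S → Residue s
    member-residue s∈S = Equivalence.from inConn⇔ (lose s∈S (inj₁ refl))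

    member-residue⁻ : ∀ {s} → s ∈ S → Residue (n ∸ s)
    member-residue⁻ s∈S = Equivalence.from inConn⇔ (lose s∈S (inj₂ refl))

    residue-cases : ∀ {s t d} → (∀ {x} → x ∈ S → x ≡ s ⊎ x ≡ t) → Residue d →
                    d ≡ s ⊎ d ≡ n ∸ s ⊎ d ≡ t ⊎ d ≡ n ∸ t
    residue-cases S⊆st r with find (Equivalence.to inConn⇔ r)
    ... | x , x∈S , x≡d⊎n∸x≡d with S⊆st x∈S | x≡d⊎n∸x≡d
    ...   | inj₁ refl | inj₁ refl = inj₁ refl
    ...   | inj₁ refl | inj₂ refl = inj₂ (inj₁ refl)
    ...   | inj₂ refl | inj₁ refl = inj₂ (inj₂ (inj₁ refl))
    ...   | inj₂ refl | inj₂ refl = inj₂ (inj₂ (inj₂ refl))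

    too-few-residues : ∀ xs → length xs < 4 → (∀ {d} → Residue d → d ∈ xs) → ⊥
    too-few-residues xs short covers =
      <⇒≢ (≤-<-trans (count≤length n (inConn n S) xs (λ _ _ → covers)) short) size

    -- x < y < z < n ∸ y < n ∸ x are five residues
    no-three-ascending : ∀ {x y z} → x ∈ S → y ∈ S → z ∈ S → x < y → y < z → ⊥
    no-three-ascending {x} {y} {z} x∈S y∈S z∈S x<y y<z =
      <⇒≱ (s≤s ≤-refl) (subst (5 ≤_) size (length≤count n (inConn n S) _ ascending))
      where
      0<x : 0 < x
      0<x = proj₁ (member-bounds x∈S)
      z+z≤n : z + z ≤ n
      z+z≤n = proj₂ (member-bounds z∈S)
      y+z<n : y + z < n
      y+z<n = <-≤-trans (+-monoˡ-< z y<z) z+z≤n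
      z<n : z < n
      z<n = <-≤-trans (m<m+n z (<-trans (<-trans 0<x x<y) y<z)) z+z≤n
      y<n : y < n
      y<n = <-trans y<z z<n
      x<n : x < n
      x<n = <-trans x<y y<n
      z<n∸y : z < n ∸ y
      z<n∸y = subst (_< n ∸ y) (m+n∸m≡n y z) (∸-monoˡ-< y+z<n (m≤m+n y z))
      ascending : Ascending n (inConn n S) 0 (x ∷ y ∷ z ∷ n ∸ y ∷ n ∸ x ∷ [])
      ascending = (z≤n , x<n , member-residue x∈S)
                ∷ (x<y , y<n , member-residue y∈S)
                ∷ (y<z , z<n , member-residue z∈S)
                ∷ (z<n∸y , ∸-monoʳ-< (<-trans 0<x x<y) (<⇒≤ y<n) , member-residue⁻ y∈S)
                ∷ (∸-monoʳ-< x<y (<⇒≤ y<n) , ∸-monoʳ-< 0<x (<⇒≤ x<n) , member-residue⁻ x∈S)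
                ∷ []

    no-three-distinct : ∀ {x y z} → x ∈ S → y ∈ S → z ∈ S → x ≢ y → y ≢ z → x ≢ z → ⊥
    no-three-distinct {x} {y} {z} x∈S y∈S z∈S x≢y y≢z x≢z with <-cmp x y | <-cmp y z | <-cmp x z
    ... | tri≈ _ x≡y _ | _            | _            = x≢y x≡y
    ... | _            | tri≈ _ y≡z _ | _            = y≢z y≡z
    ... | _            | _            | tri≈ _ x≡z _ = x≢z x≡z
    ... | tri< x<y _ _ | tri< y<z _ _ | _            = no-three-ascending x∈S y∈S z∈S x<y y<z
    ... | tri< x<y _ _ | tri> _ _ z<y | tri< x<z _ _ = no-three-ascending x∈S z∈S y∈S x<z z<y
    ... | tri< x<y _ _ | tri> _ _ z<y | tri> _ _ z<x = no-three-ascending z∈S x∈S y∈S z<x x<y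
    ... | tri> _ _ y<x | tri< y<z _ _ | tri< x<z _ _ = no-three-ascending y∈S x∈S z∈S y<x x<z
    ... | tri> _ _ y<x | tri< y<z _ _ | tri> _ _ z<x = no-three-ascending y∈S z∈S x∈S y<z z<x
    ... | tri> _ _ y<x | tri> _ _ z<y | _            = no-three-ascending z∈S y∈S x∈S z<y y<x

    ordered : ∀ {s t} → s < t → s ∈ S → t ∈ S → (∀ {x} → x ∈ S → x ≡ s ⊎ x ≡ t) → TwoGenerators n S
    ordered {s} {t} s<t s∈S t∈S S⊆st = record
      { a = s ; b = t ; 0<a = proj₁ (member-bounds s∈S) ; a<b = s<t
      ; b+b<n = ≤∧≢⇒< (proj₂ (member-bounds t∈S)) t+t≢n
      ; a∈S = s∈S ; b∈S = t∈S ; S⊆ab = S⊆st }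
      where
      t+t≢n : t + t ≢ n
      t+t≢n t+t≡n = too-few-residues (s ∷ n ∸ s ∷ t ∷ []) ≤-refl covers
        where
        covers : ∀ {d} → Residue d → d ∈ s ∷ n ∸ s ∷ t ∷ []
        covers r with residue-cases S⊆st r
        ... | inj₁ d≡s                = here d≡s
        ... | inj₂ (inj₁ d≡n∸s)       = there (here d≡n∸s)
        ... | inj₂ (inj₂ (inj₁ d≡t))  = there (there (here d≡t))
        ... | inj₂ (inj₂ (inj₂ refl)) =
          there (there (here (trans (cong (_∸ t) (sym t+t≡n)) (m+n∸n≡m t t))))

    single-value : ∀ {s} → (∀ {x} → x ∈ S → x ≡ s) → ⊥
    single-value {s} S⊆s = too-few-residues (s ∷ n ∸ s ∷ []) (s≤s (s≤s (s≤s z≤n))) covers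
      where
      covers : ∀ {d} → Residue d → d ∈ s ∷ n ∸ s ∷ []
      covers r with residue-cases (inj₁ ∘ S⊆s) r
      ... | inj₁ d≡s                 = here d≡s
      ... | inj₂ (inj₁ d≡n∸s)        = there (here d≡n∸s)
      ... | inj₂ (inj₂ (inj₁ d≡s))   = here d≡s
      ... | inj₂ (inj₂ (inj₂ d≡n∸s)) = there (here d≡n∸s)

    some-member : ∃ (_∈ S)
    some-member with Any.any? (λ _ → yes tt) S
    ... | yes p = let s , s∈S , _ = find p in s , s∈S
    ... | no ¬p = ⊥-elim (too-few-residues [] z<s
                    (⊥-elim ∘ ¬p ∘ Any.map (λ _ → tt) ∘ Equivalence.to inConn⇔))

  twoGenerators : TwoGenerators n S
  twoGenerators with some-member
  ... | s , s∈S with All.all? (_≟ s) S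
  ...   | yes all≡s = ⊥-elim (single-value (All.lookup all≡s))
  ...   | no ¬all≡s with find (¬All⇒Any¬ (_≟ s) S ¬all≡s)
  ...     | t , t∈S , t≢s with All.all? (λ x → x ≟ s ⊎-dec x ≟ t) S
  ...       | no ¬all∈st =
    let c , c∈S , c∉st = find (¬All⇒Any¬ (λ x → x ≟ s ⊎-dec x ≟ t) S ¬all∈st)
    in ⊥-elim (no-three-distinct s∈S t∈S c∈S (t≢s ∘ sym) (c∉st ∘ inj₂ ∘ sym) (c∉st ∘ inj₁ ∘ sym))
  ...       | yes all∈st with <-cmp s t
  ...         | tri< s<t _ _ = ordered s<t s∈S t∈S (All.lookup all∈st)
  ...         | tri≈ _ s≡t _ = ⊥-elim (t≢s (sym s≡t))
  ...         | tri> _ _ t<s = ordered t<s t∈S s∈S (Sum.swap ∘ All.lookup all∈st)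

data Generator : Set where
  a⁺ a⁻ b⁺ b⁻ : Generator

neg : Generator → Generator
neg a⁺ = a⁻
neg a⁻ = a⁺
neg b⁺ = b⁻
neg b⁻ = b⁺

neg-injective : ∀ {g h} → neg g ≡ neg h → g ≡ h
neg-injective {a⁺} {a⁺} _ = refl
neg-injective {a⁻} {a⁻} _ = refl
neg-injective {b⁺} {b⁺} _ = refl
neg-injective {b⁻} {b⁻} _ = refl

residue : (n a b : ℕ) → Generator → ℕ
residue n a b a⁺ = a
residue n a b a⁻ = n ∸ a
residue n a b b⁺ = b
residue n a b b⁻ = n ∸ b

circulant⇔ : ∀ {n S a b} → a ∈ S → b ∈ S → (∀ {s} → s ∈ S → s ≡ a ⊎ s ≡ b) → ∀ x y →
             Circulant n S x y ⇔ ∃ λ g → diffMod n x y ≡ residue n a b g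
circulant⇔ {n} {S} {a} {b} a∈S b∈S S⊆ab x y = mk⇔ to from
  where
  to : Circulant n S x y → ∃ λ g → diffMod n x y ≡ residue n a b g
  to adj with find (Equivalence.to inConn⇔ adj)
  ... | s , s∈S , s≡d⊎n∸s≡d with S⊆ab s∈S | s≡d⊎n∸s≡d
  ...   | inj₁ refl | inj₁ s≡d   = a⁺ , sym s≡d
  ...   | inj₁ refl | inj₂ n∸s≡d = a⁻ , sym n∸s≡d
  ...   | inj₂ refl | inj₁ s≡d   = b⁺ , sym s≡d
  ...   | inj₂ refl | inj₂ n∸s≡d = b⁻ , sym n∸s≡d
  from : (∃ λ g → diffMod n x y ≡ residue n a b g) → Circulant n S x y
  from (a⁺ , d≡) = Equivalence.from inConn⇔ (lose a∈S (inj₁ (sym d≡)))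
  from (a⁻ , d≡) = Equivalence.from inConn⇔ (lose a∈S (inj₂ (sym d≡)))
  from (b⁺ , d≡) = Equivalence.from inConn⇔ (lose b∈S (inj₁ (sym d≡)))
  from (b⁻ , d≡) = Equivalence.from inConn⇔ (lose b∈S (inj₂ (sym d≡)))

residue-scale : ∀ {n q a b} → n ≡ q * a → b ≡ 2 * a → ∀ g → residue n a b g ≡ residue q 1 2 g * a
residue-scale {a = a} n≡q*a b≡2a a⁺ = sym (*-identityˡ a)
residue-scale {q = q} {a} n≡q*a b≡2a a⁻ =
  trans (cong₂ _∸_ n≡q*a (sym (*-identityˡ a))) (sym (*-distribʳ-∸ a q 1))
residue-scale n≡q*a b≡2a b⁺ = b≡2a
residue-scale {q = q} {a} n≡q*a b≡2a b⁻ = trans (cong₂ _∸_ n≡q*a b≡2a) (sym (*-distribʳ-∸ a q 2))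

C[1,2] : (q : ℕ) → Graph (Fin q)
C[1,2] q = Circulant q (1 ∷ 2 ∷ [])

cycleSucc-irreflexive : ∀ {m t u} → CycleSucc (3 + m) t u → u ≢ t
cycleSucc-irreflexive (inj₁ refl)        = 1+n≢n
cycleSucc-irreflexive (inj₂ (() , refl)) refl

cycleSucc-distinct : ∀ {m t u w} → CycleSucc (3 + m) t u → CycleSucc (3 + m) w t → u ≢ w
cycleSucc-distinct {w = w} (inj₁ refl) (inj₁ refl) = <⇒≢ (<-trans (n<1+n w) (n<1+n (suc w))) ∘ sym
cycleSucc-distinct (inj₁ refl)        (inj₂ (() , refl)) refl
cycleSucc-distinct (inj₂ (() , refl)) (inj₁ refl)        refl
cycleSucc-distinct (inj₂ (() , refl)) (inj₂ (_ , refl))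

cycle-successor : ∀ {m} (i : Fin (3 + m)) → ∃ λ (j : Fin (3 + m)) → CycleSucc (3 + m) (toℕ i) (toℕ j)
cycle-successor {m} i with suc (toℕ i) <? 3 + m
... | yes 1+i<3+m = fromℕ< 1+i<3+m , inj₁ (toℕ-fromℕ< 1+i<3+m)
... | no  1+i≮3+m = zero , inj₂ (≤-antisym (toℕ<n i) (≮⇒≥ 1+i≮3+m) , refl)

cycle-predecessor : ∀ {m} (i : Fin (3 + m)) → ∃ λ (l : Fin (3 + m)) → CycleSucc (3 + m) (toℕ l) (toℕ i)
cycle-predecessor {m} zero = fromℕ (2 + m) , inj₂ (cong suc (toℕ-fromℕ (2 + m)) , refl)
cycle-predecessor (suc i)  = inject₁ i , inj₁ (cong suc (sym (toℕ-inject₁ i)))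

cycle-neighbours : ∀ {m} (i : Fin (3 + m)) →
                   ∃₂ λ j l → Cycle (3 + m) j i × Cycle (3 + m) l i × j ≢ l × j ≢ i × l ≢ i
cycle-neighbours i with cycle-successor i | cycle-predecessor i
... | j , i→j | l , l→i =
  j , l , inj₂ i→j , inj₁ l→i , cycleSucc-distinct i→j l→i ∘ cong toℕ ,
  cycleSucc-irreflexive i→j ∘ cong toℕ , cycleSucc-irreflexive l→i ∘ cong toℕ ∘ sym

reachable-snoc : ∀ {V : Set} {G : Graph V} {x y z} → Reachable G x y → G y z → Reachable G x z
reachable-snoc here           y~z = step y~z here
reachable-snoc (step x~w w→y) y~z = step x~w (reachable-snoc w→y y~z)

record _≅_ {W′ W : Set} (H′ : Graph W′) (H : Graph W) : Set where
  field
    to        : W′ → W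
    from      : W → W′
    from∘to   : ∀ x → from (to x) ≡ x
    to∘from   : ∀ y → to (from y) ≡ y
    adjacent⇔ : ∀ x y → H′ x y ⇔ H (to x) (to y)

componentIso-≅ : ∀ {V W′ W : Set} {G : Graph V} {v} {H′ : Graph W′} {H : Graph W} →
                 H′ ≅ H → ComponentIso G v H → ComponentIso G v H′
componentIso-≅ σ (f , f-injective , reach , surjective , hom , hom⁻¹) =
  f ∘ to , injective , reach ∘ to , surjective′ ,
  (λ x y → hom (to x) (to y) ∘ Equivalence.to (adjacent⇔ x y)) ,
  (λ x y → Equivalence.from (adjacent⇔ x y) ∘ hom⁻¹ (to x) (to y))
  where
  open _≅_ σ
  injective : ∀ {x y} → f (to x) ≡ f (to y) → x ≡ y
  injective {x} {y} eq = trans (sym (from∘to x)) (trans (cong from (f-injective eq)) (from∘to y))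
  surjective′ : ∀ u → _ → ∃ λ x → f (to x) ≡ u
  surjective′ u v→u with surjective u v→u
  ... | y , fy≡u = from y , trans (cong f (to∘from y)) fy≡u

_⇔-dec_ : ∀ {A B : Set} → Dec A → Dec B → Dec (A ⇔ B)
yes a ⇔-dec yes b = yes (mk⇔ (λ _ → b) (λ _ → a))
no ¬a ⇔-dec no ¬b = yes (mk⇔ (⊥-elim ∘ ¬a) (⊥-elim ∘ ¬b))
yes a ⇔-dec no ¬b = no (λ a⇔b → ¬b (Equivalence.to a⇔b a))
no ¬a ⇔-dec yes b = no (λ a⇔b → ¬a (Equivalence.from a⇔b b))

C[1,2]? : ∀ q (i j : Fin q) → Dec (C[1,2] q i j)
C[1,2]? q i j = T? (inConn q (1 ∷ 2 ∷ []) (diffMod q i j))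

K5≅C[1,2] : K5 ≅ C[1,2] 5
K5≅C[1,2] = record
  { to = id ; from = id ; from∘to = λ _ → refl ; to∘from = λ _ → refl
  ; adjacent⇔ = from-yes (all? λ x → all? λ y → ¬? (x Fin.≟ y) ⇔-dec C[1,2]? 5 x y) }

SigmaC4? : ∀ x y → Dec (SigmaC4 x y)
SigmaC4? x y =
  (toℕ x <? 4 ×-dec toℕ y <? 4 ×-dec (cycleSucc? (toℕ x) (toℕ y) ⊎-dec cycleSucc? (toℕ y) (toℕ x)))
  ⊎-dec (toℕ x <? 4 ×-dec 4 ≤? toℕ y)
  ⊎-dec (4 ≤? toℕ x ×-dec toℕ y <? 4)
  where
  cycleSucc? : ∀ i j → Dec (CycleSucc 4 i j)
  cycleSucc? i j = j ≟ suc i ⊎-dec (suc i ≟ 4 ×-dec j ≟ 0)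

-- Both graphs are K₆ minus a perfect matching: the non-edges {0,2}, {1,3}, {4,5} of ΣC₄ go
-- to the antipodal pairs of C₆(1,2).
ΣC4→C[1,2] : Fin 6 → Fin 6
ΣC4→C[1,2] = lookup (# 0 ∷ # 1 ∷ # 3 ∷ # 4 ∷ # 2 ∷ # 5 ∷ [])

C[1,2]→ΣC4 : Fin 6 → Fin 6
C[1,2]→ΣC4 = lookup (# 0 ∷ # 1 ∷ # 4 ∷ # 2 ∷ # 3 ∷ # 5 ∷ [])

ΣC4≅C[1,2] : SigmaC4 ≅ C[1,2] 6
ΣC4≅C[1,2] = record
  { to        = ΣC4→C[1,2]
  ; from      = C[1,2]→ΣC4
  ; from∘to   = from-yes (all? λ x → C[1,2]→ΣC4 (ΣC4→C[1,2] x) Fin.≟ x)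
  ; to∘from   = from-yes (all? λ y → ΣC4→C[1,2] (C[1,2]→ΣC4 y) Fin.≟ y)
  ; adjacent⇔ = from-yes (all? λ x → all? λ y →
                  SigmaC4? x y ⇔-dec C[1,2]? 6 (ΣC4→C[1,2] x) (ΣC4→C[1,2] y)) }

-- Wheels force b = 2a and n ∈ {5a, 6a}

module DifferenceGraph {n a b : ℕ} .{{_ : NonZero n}} (0<a : 0 < a) (a<b : a < b) (b+b<n : b + b < n) where

  ⟦_⟧ : Generator → ℕ
  ⟦_⟧ = residue n a b

  a≤b : a ≤ b
  a≤b = <⇒≤ a<b

  0<b : 0 < b
  0<b = <-trans 0<a a<b

  b<n : b < n
  b<n = <-≤-trans (m<m+n b 0<b) (<⇒≤ b+b<n)

  a<n : a < n
  a<n = <-trans a<b b<n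

  a+a<n : a + a < n
  a+a<n = ≤-<-trans (+-mono-≤ a≤b a≤b) b+b<n

  a+b<n : a + b < n
  a+b<n = ≤-<-trans (+-monoˡ-≤ b a≤b) b+b<n

  b+a<n : b + a < n
  b+a<n = ≤-<-trans (+-monoʳ-≤ b a≤b) b+b<n

  n∸b+a<n : n ∸ b + a < n
  n∸b+a<n = subst (n ∸ b + a <_) (m∸n+n≡m (<⇒≤ b<n)) (+-monoʳ-< (n ∸ b) a<b)

  0<⟦_⟧ : ∀ g → 0 < ⟦ g ⟧
  0<⟦ a⁺ ⟧ = 0<a
  0<⟦ a⁻ ⟧ = m<n⇒0<n∸m a<n
  0<⟦ b⁺ ⟧ = 0<b
  0<⟦ b⁻ ⟧ = m<n⇒0<n∸m b<n

  ⟦_⟧<n : ∀ g → ⟦ g ⟧ < n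
  ⟦ a⁺ ⟧<n = a<n
  ⟦ a⁻ ⟧<n = ∸-monoʳ-< 0<a (<⇒≤ a<n)
  ⟦ b⁺ ⟧<n = b<n
  ⟦ b⁻ ⟧<n = ∸-monoʳ-< 0<b (<⇒≤ b<n)

  ⟦neg_⟧ : ∀ g → ⟦ neg g ⟧ ≡ n ∸ ⟦ g ⟧
  ⟦neg a⁺ ⟧ = refl
  ⟦neg a⁻ ⟧ = sym (m∸[m∸n]≡n (<⇒≤ a<n))
  ⟦neg b⁺ ⟧ = refl
  ⟦neg b⁻ ⟧ = sym (m∸[m∸n]≡n (<⇒≤ b<n))

  linked-neg : ∀ {f g h} → ⟦ h ⟧ ≡ (⟦ f ⟧ + ⟦ g ⟧) % n → ⟦ neg h ⟧ ≡ (⟦ neg f ⟧ + ⟦ neg g ⟧) % n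
  linked-neg {f} {g} {h} eq = begin
    ⟦ neg h ⟧                       ≡⟨ ⟦neg h ⟧ ⟩
    n ∸ ⟦ h ⟧                       ≡⟨ ∸-%-complement 0<⟦ h ⟧ ⟦ h ⟧<n (<⇒≤ ⟦ f ⟧<n) (<⇒≤ ⟦ g ⟧<n) eq ⟩
    (n ∸ ⟦ f ⟧ + (n ∸ ⟦ g ⟧)) % n   ≡⟨ cong₂ (λ u w → (u + w) % n) ⟦neg f ⟧ ⟦neg g ⟧ ⟨
    (⟦ neg f ⟧ + ⟦ neg g ⟧) % n     ∎
    where open ≡-Reasoning

  Doubling OppositeA OppositeB Crossed Exceptional : Set
  Doubling    = b ≡ a + a
  OppositeA   = b ≡ a + a ⊎ n ≡ a + a + b ⊎ n ≡ a + a + a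
  OppositeB   = n ≡ a + b + b ⊎ n ≡ b + b + b
  Crossed     = n ≡ a + a + b ⊎ n ≡ a + b + b
  Exceptional = b ≡ 2 * a × (n ≡ 5 * a ⊎ n ≡ 6 * a)

  exceptional? : Dec Exceptional
  exceptional? = b ≟ 2 * a ×-dec (n ≟ 5 * a ⊎-dec n ≟ 6 * a)

  -- The condition on n, a and b under which h − g can be a generator as well (this is what
  -- linked⇒compatible establishes); it is invariant under negation by construction.
  Compatible : Generator → Generator → Set
  Compatible a⁺ h = a⁺-partner h
    where
    a⁺-partner : Generator → Set
    a⁺-partner a⁺ = ⊥
    a⁺-partner a⁻ = OppositeA
    a⁺-partner b⁺ = Doubling
    a⁺-partner b⁻ = Crossed
  Compatible b⁺ h = b⁺-partner h
    where
    b⁺-partner : Generator → Set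
    b⁺-partner a⁺ = Doubling
    b⁺-partner a⁻ = Crossed
    b⁺-partner b⁺ = ⊥
    b⁺-partner b⁻ = OppositeB
  Compatible a⁻ h = Compatible a⁺ (neg h)
  Compatible b⁻ h = Compatible b⁺ (neg h)

  private
    reduce : ∀ {x z} → x < n → z ≡ x % n → z ≡ x
    reduce x<n eq = trans eq (m<n⇒m%n≡m x<n)

    complement : ∀ {x y} → x < n → n ∸ x ≡ y → n ≡ x + y
    complement x<n eq = trans (sym (m+[n∸m]≡n (<⇒≤ x<n))) (cong (_ +_) eq)

    wrap : ∀ {x} → x < n → (n ∸ x + x) % n ≡ 0
    wrap x<n = trans (cong (_% n) (m∸n+n≡m (<⇒≤ x<n))) (n%n≡0 n)

    [n∸a+b]%n≡b∸a : (n ∸ a + b) % n ≡ b ∸ a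
    [n∸a+b]%n≡b∸a = begin
      (n ∸ a + b) % n             ≡⟨ cong (λ w → (n ∸ a + w) % n) (m+[n∸m]≡n a≤b) ⟨
      (n ∸ a + (a + (b ∸ a))) % n ≡⟨ cong (_% n) (+-assoc (n ∸ a) a (b ∸ a)) ⟨
      (n ∸ a + a + (b ∸ a)) % n   ≡⟨ cong (λ w → (w + (b ∸ a)) % n) (m∸n+n≡m (<⇒≤ a<n)) ⟩
      (n + (b ∸ a)) % n           ≡⟨ cong (_% n) (+-comm n (b ∸ a)) ⟩
      (b ∸ a + n) % n             ≡⟨ [m+n]%n≡m%n (b ∸ a) n ⟩
      (b ∸ a) % n                 ≡⟨ m<n⇒m%n≡m (≤-<-trans (m∸n≤m b a) b<n) ⟩
      b ∸ a                       ∎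
      where open ≡-Reasoning

    shift : ∀ {x y z} → y < n → x ≡ n ∸ y + z → y + x ≡ n + z
    shift {x} {y} {z} y<n eq = trans (cong (y +_) eq)
      (trans (sym (+-assoc y (n ∸ y) z)) (cong (_+ z) (m+[n∸m]≡n (<⇒≤ y<n))))

  a⁺-linked : ∀ {f h} → a⁺ ≢ h → ⟦ h ⟧ ≡ (⟦ f ⟧ + a) % n → Compatible a⁺ h
  a⁺-linked {a⁻} {h} _ eq = ⊥-elim (<⇒≢ 0<⟦ h ⟧ (sym (trans eq (wrap a<n))))
  a⁺-linked {_} {a⁺} a⁺≢a⁺ _ = ⊥-elim (a⁺≢a⁺ refl)
  a⁺-linked {a⁺} {a⁻} _ eq =
    inj₂ (inj₂ (trans (complement a<n (reduce a+a<n eq)) (solve (a ∷ []))))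
  a⁺-linked {b⁺} {a⁻} _ eq =
    inj₂ (inj₁ (trans (complement a<n (reduce b+a<n eq)) (solve (a ∷ b ∷ []))))
  a⁺-linked {b⁻} {a⁻} _ eq = inj₁ (+-cancelʳ-≡ (n ∸ a) b (a + a) (begin
    b + (n ∸ a)     ≡⟨ shift b<n (reduce n∸b+a<n eq) ⟩
    n + a           ≡⟨ cong (_+ a) (m+[n∸m]≡n (<⇒≤ a<n)) ⟨
    a + (n ∸ a) + a ≡⟨ +-swapʳ a (n ∸ a) a ⟩
    a + a + (n ∸ a) ∎))
    where
    open ≡-Reasoning
    +-swapʳ : ∀ x y z → x + y + z ≡ x + z + y
    +-swapʳ = solve-∀
  a⁺-linked {a⁺} {b⁺} _ eq = reduce a+a<n eq
  a⁺-linked {b⁺} {b⁺} _ eq = ⊥-elim (<⇒≢ (m<m+n b 0<a) (reduce b+a<n eq))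
  a⁺-linked {b⁻} {b⁺} _ eq =
    ⊥-elim (<⇒≢ (<-≤-trans b+b<n (m≤m+n n a)) (shift b<n (reduce n∸b+a<n eq)))
  a⁺-linked {a⁺} {b⁻} _ eq =
    inj₁ (trans (complement b<n (reduce a+a<n eq)) (solve (a ∷ b ∷ [])))
  a⁺-linked {b⁺} {b⁻} _ eq =
    inj₂ (trans (complement b<n (reduce b+a<n eq)) (solve (a ∷ b ∷ [])))
  a⁺-linked {b⁻} {b⁻} _ eq = ⊥-elim (<⇒≢ (m<m+n (n ∸ b) 0<a) (reduce n∸b+a<n eq))

  b⁺-linked : ∀ {f h} → b⁺ ≢ h → ⟦ h ⟧ ≡ (⟦ f ⟧ + b) % n → Compatible b⁺ h
  b⁺-linked {b⁻} {h} _ eq = ⊥-elim (<⇒≢ 0<⟦ h ⟧ (sym (trans eq (wrap b<n))))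
  b⁺-linked {_} {b⁺} b⁺≢b⁺ _ = ⊥-elim (b⁺≢b⁺ refl)
  b⁺-linked {a⁺} {a⁺} _ eq = ⊥-elim (<⇒≢ (m<m+n a 0<b) (reduce a+b<n eq))
  b⁺-linked {a⁻} {a⁺} _ eq =
    trans (sym (m+[n∸m]≡n a≤b)) (cong (a +_) (sym (trans eq [n∸a+b]%n≡b∸a)))
  b⁺-linked {b⁺} {a⁺} _ eq = ⊥-elim (<⇒≢ (<-≤-trans a<b (m≤m+n b b)) (reduce b+b<n eq))
  b⁺-linked {a⁺} {a⁻} _ eq =
    inj₁ (trans (complement a<n (reduce a+b<n eq)) (solve (a ∷ b ∷ [])))
  b⁺-linked {a⁻} {a⁻} _ eq =
    ⊥-elim (<⇒≢ b<n (trans (sym (m+[n∸m]≡n a≤b)) (sym (complement a<n (trans eq [n∸a+b]%n≡b∸a)))))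
  b⁺-linked {b⁺} {a⁻} _ eq =
    inj₂ (trans (complement a<n (reduce b+b<n eq)) (solve (a ∷ b ∷ [])))
  b⁺-linked {a⁺} {b⁻} _ eq =
    inj₁ (trans (complement b<n (reduce a+b<n eq)) (solve (a ∷ b ∷ [])))
  b⁺-linked {a⁻} {b⁻} _ eq =
    ⊥-elim (<⇒≢ (≤-<-trans (+-monoʳ-≤ b (m∸n≤m b a)) b+b<n)
                (sym (complement b<n (trans eq [n∸a+b]%n≡b∸a))))
  b⁺-linked {b⁺} {b⁻} _ eq =
    inj₂ (trans (complement b<n (reduce b+b<n eq)) (solve (b ∷ [])))

  linked⇒compatible : ∀ g {f h} → g ≢ h → ⟦ h ⟧ ≡ (⟦ f ⟧ + ⟦ g ⟧) % n → Compatible g h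
  linked⇒compatible a⁺ {f} = a⁺-linked {f}
  linked⇒compatible b⁺ {f} = b⁺-linked {f}
  linked⇒compatible a⁻ {f} {h} g≢h eq =
    a⁺-linked {neg f} (g≢h ∘ neg-injective) (linked-neg {f} {a⁻} {h} eq)
  linked⇒compatible b⁻ {f} {h} g≢h eq =
    b⁺-linked {neg f} (g≢h ∘ neg-injective) (linked-neg {f} {b⁻} {h} eq)

  Branching : Generator → Set
  Branching g = ∃₂ λ h₁ h₂ → h₁ ≢ h₂ × Compatible g h₁ × Compatible g h₂

  branching-a⁻ : Branching a⁻ → Branching a⁺
  branching-a⁻ (h₁ , h₂ , h₁≢h₂ , c₁ , c₂) = neg h₁ , neg h₂ , h₁≢h₂ ∘ neg-injective , c₁ , c₂

  branching-b⁻ : Branching b⁻ → Branching b⁺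
  branching-b⁻ (h₁ , h₂ , h₁≢h₂ , c₁ , c₂) = neg h₁ , neg h₂ , h₁≢h₂ ∘ neg-injective , c₁ , c₂

  branching-a⁺ : Branching a⁺ → Doubling ⊎ OppositeA
  branching-a⁺ (a⁺ , _  , _     , ()  , _)
  branching-a⁺ (_  , a⁺ , _     , _   , ())
  branching-a⁺ (a⁻ , _  , _     , opp , _)   = inj₂ opp
  branching-a⁺ (_  , a⁻ , _     , _   , opp) = inj₂ opp
  branching-a⁺ (b⁺ , _  , _     , dbl , _)   = inj₁ dbl
  branching-a⁺ (_  , b⁺ , _     , _   , dbl) = inj₁ dbl
  branching-a⁺ (b⁻ , b⁻ , h₁≢h₂ , _)         = ⊥-elim (h₁≢h₂ refl)

  branching-b⁺ : Branching b⁺ → (Doubling ⊎ OppositeB) × (OppositeB ⊎ Crossed)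
  branching-b⁺ (b⁺ , _  , _     , ()  , _)
  branching-b⁺ (_  , b⁺ , _     , _   , ())
  branching-b⁺ (a⁺ , a⁻ , _     , dbl , crs) = inj₁ dbl , inj₂ crs
  branching-b⁺ (a⁻ , a⁺ , _     , crs , dbl) = inj₁ dbl , inj₂ crs
  branching-b⁺ (a⁺ , b⁻ , _     , dbl , opp) = inj₁ dbl , inj₁ opp
  branching-b⁺ (b⁻ , a⁺ , _     , opp , dbl) = inj₁ dbl , inj₁ opp
  branching-b⁺ (a⁻ , b⁻ , _     , _   , opp) = inj₂ opp , inj₁ opp
  branching-b⁺ (b⁻ , a⁻ , _     , opp , _)   = inj₂ opp , inj₁ opp
  branching-b⁺ (a⁺ , a⁺ , h₁≢h₂ , _)         = ⊥-elim (h₁≢h₂ refl)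
  branching-b⁺ (a⁻ , a⁻ , h₁≢h₂ , _)         = ⊥-elim (h₁≢h₂ refl)
  branching-b⁺ (b⁻ , b⁻ , h₁≢h₂ , _)         = ⊥-elim (h₁≢h₂ refl)

  opposites⇒doubling : OppositeA → OppositeB → Doubling
  opposites⇒doubling (inj₁ dbl)        _          = dbl
  opposites⇒doubling (inj₂ (inj₁ n≡₁)) (inj₁ n≡₂) =
    ⊥-elim (<⇒≢ (+-monoˡ-< b (+-monoʳ-< a a<b)) (trans (sym n≡₁) n≡₂))
  opposites⇒doubling (inj₂ (inj₁ n≡₁)) (inj₂ n≡₂) =
    ⊥-elim (<⇒≢ (+-monoˡ-< b (+-mono-< a<b a<b)) (trans (sym n≡₁) n≡₂))
  opposites⇒doubling (inj₂ (inj₂ n≡₁)) (inj₁ n≡₂) =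
    ⊥-elim (<⇒≢ (+-mono-< (+-monoʳ-< a a<b) a<b) (trans (sym n≡₁) n≡₂))
  opposites⇒doubling (inj₂ (inj₂ n≡₁)) (inj₂ n≡₂) =
    ⊥-elim (<⇒≢ (+-mono-< (+-mono-< a<b a<b) a<b) (trans (sym n≡₁) n≡₂))

  doubling⇒exceptional : Doubling → OppositeB ⊎ Crossed → Exceptional
  doubling⇒exceptional dbl rest = trans dbl (solve (a ∷ [])) , n≡5a⊎n≡6a rest
    where
    n≡5a⊎n≡6a : OppositeB ⊎ Crossed → n ≡ 5 * a ⊎ n ≡ 6 * a
    n≡5a⊎n≡6a (inj₁ (inj₁ n≡)) = inj₁ (trans n≡ (trans (cong (λ x → a + x + x) dbl) (solve (a ∷ []))))
    n≡5a⊎n≡6a (inj₁ (inj₂ n≡)) = inj₂ (trans n≡ (trans (cong (λ x → x + x + x) dbl) (solve (a ∷ []))))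
    n≡5a⊎n≡6a (inj₂ (inj₁ n≡)) = ⊥-elim (<⇒≢ b+b<n (sym (trans n≡ (cong (_+ b) (sym dbl)))))
    n≡5a⊎n≡6a (inj₂ (inj₂ n≡)) = inj₁ (trans n≡ (trans (cong (λ x → a + x + x) dbl) (solve (a ∷ []))))

  exceptional : Branching a⁺ → Branching b⁺ → Exceptional
  exceptional at-a at-b = doubling⇒exceptional doubling (proj₂ (branching-b⁺ at-b))
    where
    doubling : Doubling
    doubling with branching-a⁺ at-a | proj₁ (branching-b⁺ at-b)
    ... | inj₁ dbl | _        = dbl
    ... | inj₂ opp | inj₁ dbl = dbl
    ... | inj₂ opp | inj₂ opq = opposites⇒doubling opp opq

  three-branching⇒a⁺ : ∀ {x y z} → x ≢ y → y ≢ z → x ≢ z →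
                       Branching x → Branching y → Branching z → Branching a⁺
  three-branching⇒a⁺ {a⁺}           _   _   _   bx _  _  = bx
  three-branching⇒a⁺ {a⁻}           _   _   _   bx _  _  = branching-a⁻ bx
  three-branching⇒a⁺ {_}  {a⁺}      _   _   _   _  by _  = by
  three-branching⇒a⁺ {_}  {a⁻}      _   _   _   _  by _  = branching-a⁻ by
  three-branching⇒a⁺ {_}  {_}  {a⁺} _   _   _   _  _  bz = bz
  three-branching⇒a⁺ {_}  {_}  {a⁻} _   _   _   _  _  bz = branching-a⁻ bz
  three-branching⇒a⁺ {b⁺} {b⁺}      x≢y _   _   _  _  _  = ⊥-elim (x≢y refl)
  three-branching⇒a⁺ {b⁻} {b⁻}      x≢y _   _   _  _  _  = ⊥-elim (x≢y refl)
  three-branching⇒a⁺ {_}  {b⁺} {b⁺} _   y≢z _   _  _  _  = ⊥-elim (y≢z refl)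
  three-branching⇒a⁺ {_}  {b⁻} {b⁻} _   y≢z _   _  _  _  = ⊥-elim (y≢z refl)
  three-branching⇒a⁺ {b⁺} {_}  {b⁺} _   _   x≢z _  _  _  = ⊥-elim (x≢z refl)
  three-branching⇒a⁺ {b⁻} {_}  {b⁻} _   _   x≢z _  _  _  = ⊥-elim (x≢z refl)

  three-branching⇒b⁺ : ∀ {x y z} → x ≢ y → y ≢ z → x ≢ z →
                       Branching x → Branching y → Branching z → Branching b⁺
  three-branching⇒b⁺ {b⁺}           _   _   _   bx _  _  = bx
  three-branching⇒b⁺ {b⁻}           _   _   _   bx _  _  = branching-b⁻ bx
  three-branching⇒b⁺ {_}  {b⁺}      _   _   _   _  by _  = by
  three-branching⇒b⁺ {_}  {b⁻}      _   _   _   _  by _  = branching-b⁻ by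
  three-branching⇒b⁺ {_}  {_}  {b⁺} _   _   _   _  _  bz = bz
  three-branching⇒b⁺ {_}  {_}  {b⁻} _   _   _   _  _  bz = branching-b⁻ bz
  three-branching⇒b⁺ {a⁺} {a⁺}      x≢y _   _   _  _  _  = ⊥-elim (x≢y refl)
  three-branching⇒b⁺ {a⁻} {a⁻}      x≢y _   _   _  _  _  = ⊥-elim (x≢y refl)
  three-branching⇒b⁺ {_}  {a⁺} {a⁺} _   y≢z _   _  _  _  = ⊥-elim (y≢z refl)
  three-branching⇒b⁺ {_}  {a⁻} {a⁻} _   y≢z _   _  _  _  = ⊥-elim (y≢z refl)
  three-branching⇒b⁺ {a⁺} {_}  {a⁺} _   _   x≢z _  _  _  = ⊥-elim (x≢z refl)
  three-branching⇒b⁺ {a⁻} {_}  {a⁻} _   _   x≢z _  _  _  = ⊥-elim (x≢z refl)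

-- The component of v when n = qa and b = 2a

module Orbit {n q a : ℕ} .{{_ : NonZero n}} .{{_ : NonZero q}} .{{_ : NonZero a}}
             (n≡q*a : n ≡ q * a) (v : Fin n) where

  open ≡-Reasoning

  orbit : ℕ → Fin n
  orbit t = fromℕ< (m%n<n (toℕ v + t * a) n)

  toℕ-orbit : ∀ t → toℕ (orbit t) ≡ (toℕ v + t * a) % n
  toℕ-orbit t = toℕ-fromℕ< (m%n<n (toℕ v + t * a) n)

  orbit-zero : orbit 0 ≡ v
  orbit-zero = toℕ-injective (begin
    toℕ (orbit 0)         ≡⟨ toℕ-orbit 0 ⟩
    (toℕ v + 0) % n       ≡⟨ cong (_% n) (+-identityʳ (toℕ v)) ⟩
    toℕ v % n             ≡⟨ m<n⇒m%n≡m (toℕ<n v) ⟩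
    toℕ v                 ∎)

  orbit-% : ∀ t → orbit (t % q) ≡ orbit t
  orbit-% t = toℕ-injective (begin
    toℕ (orbit (t % q))       ≡⟨ toℕ-orbit (t % q) ⟩
    (toℕ v + t % q * a) % n   ≡⟨ %-scale (toℕ v) t n≡q*a ⟨
    (toℕ v + t * a) % n       ≡⟨ toℕ-orbit t ⟨
    toℕ (orbit t)             ∎)

  a≤n : a ≤ n
  a≤n = subst (a ≤_) (sym n≡q*a) (m≤n*m a q)

  *a<n : ∀ {c} → c < q → c * a < n
  *a<n c<q = subst (_ <_) (sym n≡q*a) (*-monoˡ-< a c<q)

  diffMod-orbit : ∀ (i j : Fin q) → diffMod n (orbit (toℕ i)) (orbit (toℕ j)) ≡ diffMod q i j * a
  diffMod-orbit i j = diffMod-unique (orbit (toℕ i)) (orbit (toℕ j)) (*a<n (diffMod<n i j)) (begin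
    (d * a + toℕ (orbit (toℕ j))) % n         ≡⟨ cong (λ w → (d * a + w) % n) (toℕ-orbit (toℕ j)) ⟩
    (d * a + (toℕ v + toℕ j * a) % n) % n     ≡⟨ [m+n%d]%d≡[m+n]%d (d * a) (toℕ v + toℕ j * a) n ⟩
    (d * a + (toℕ v + toℕ j * a)) % n         ≡⟨ cong (_% n) (regroup (d * a) (toℕ v) (toℕ j * a)) ⟩
    (toℕ v + (d * a + toℕ j * a)) % n         ≡⟨ cong (λ w → (toℕ v + w) % n) (*-distribʳ-+ a d (toℕ j)) ⟨
    (toℕ v + (d + toℕ j) * a) % n             ≡⟨ %-scale (toℕ v) (d + toℕ j) n≡q*a ⟩
    (toℕ v + (d + toℕ j) % q * a) % n         ≡⟨ cong (λ w → (toℕ v + w * a) % n) (diffMod-correct i j) ⟩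
    (toℕ v + toℕ i * a) % n                   ≡⟨ toℕ-orbit (toℕ i) ⟨
    toℕ (orbit (toℕ i))                       ∎)
    where
    d : ℕ
    d = diffMod q i j
    regroup : ∀ x y z → x + (y + z) ≡ y + (x + z)
    regroup = solve-∀

  orbit-injective : ∀ {i j : Fin q} → orbit (toℕ i) ≡ orbit (toℕ j) → i ≡ j
  orbit-injective {i} {j} eq = diffMod-injectiveˡ j (*-cancelʳ-≡ _ _ a (begin
    diffMod q i j * a                             ≡⟨ diffMod-orbit i j ⟨
    diffMod n (orbit (toℕ i)) (orbit (toℕ j))     ≡⟨ cong (λ x → diffMod n x (orbit (toℕ j))) eq ⟩
    diffMod n (orbit (toℕ j)) (orbit (toℕ j))     ≡⟨ diffMod-orbit j j ⟩
    diffMod q j j * a                             ∎))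

  orbit-step : ∀ t → diffMod n (orbit t) (orbit (suc t)) ≡ n ∸ a
  orbit-step t = diffMod-unique (orbit t) (orbit (suc t)) (∸-monoʳ-< (>-nonZero⁻¹ a) a≤n) (begin
    (n ∸ a + toℕ (orbit (suc t))) % n             ≡⟨ cong (λ w → (n ∸ a + w) % n) (toℕ-orbit (suc t)) ⟩
    (n ∸ a + (toℕ v + (a + t * a)) % n) % n       ≡⟨ [m+n%d]%d≡[m+n]%d (n ∸ a) (toℕ v + (a + t * a)) n ⟩
    (n ∸ a + (toℕ v + (a + t * a))) % n           ≡⟨ cong (_% n) (regroup (n ∸ a) (toℕ v) a (t * a)) ⟩
    (toℕ v + t * a + (a + (n ∸ a))) % n           ≡⟨ cong (λ w → (toℕ v + t * a + w) % n) (m+[n∸m]≡n a≤n) ⟩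
    (toℕ v + t * a + n) % n                       ≡⟨ [m+n]%n≡m%n (toℕ v + t * a) n ⟩
    (toℕ v + t * a) % n                           ≡⟨ toℕ-orbit t ⟨
    toℕ (orbit t)                                 ∎)
    where
    regroup : ∀ x y z w → x + (y + (z + w)) ≡ y + w + (z + x)
    regroup = solve-∀

  orbit-closed : ∀ t y {c} → diffMod n (orbit t) y ≡ c * a → y ≡ orbit (t + (q ∸ c))
  orbit-closed t y {c} d≡ = toℕ-injective (begin
    toℕ y                             ≡⟨ m<n⇒m%n≡m (toℕ<n y) ⟨
    toℕ y % n                         ≡⟨ [m+n]%n≡m%n (toℕ y) n ⟨
    (toℕ y + n) % n                   ≡⟨ cong (λ w → (toℕ y + w) % n) n≡c*a+r ⟩
    (toℕ y + (c * a + r)) % n         ≡⟨ cong (_% n) (regroup (toℕ y) (c * a) r) ⟩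
    (c * a + toℕ y + r) % n           ≡⟨ [m%d+n]%d≡[m+n]%d (c * a + toℕ y) r n ⟨
    ((c * a + toℕ y) % n + r) % n     ≡⟨ cong (λ w → (w + r) % n) c*a+y≡orbit ⟩
    (toℕ (orbit t) + r) % n           ≡⟨ cong (λ w → (w + r) % n) (toℕ-orbit t) ⟩
    ((toℕ v + t * a) % n + r) % n     ≡⟨ [m%d+n]%d≡[m+n]%d (toℕ v + t * a) r n ⟩
    (toℕ v + t * a + r) % n           ≡⟨ cong (_% n) (+-assoc (toℕ v) (t * a) r) ⟩
    (toℕ v + (t * a + r)) % n         ≡⟨ cong (λ w → (toℕ v + w) % n) (*-distribʳ-+ a t (q ∸ c)) ⟨
    (toℕ v + (t + (q ∸ c)) * a) % n   ≡⟨ toℕ-orbit (t + (q ∸ c)) ⟨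
    toℕ (orbit (t + (q ∸ c)))         ∎)
    where
    r : ℕ
    r = (q ∸ c) * a
    c*a+y≡orbit : (c * a + toℕ y) % n ≡ toℕ (orbit t)
    c*a+y≡orbit = trans (cong (λ w → (w + toℕ y) % n) (sym d≡)) (diffMod-correct (orbit t) y)
    c<q : c < q
    c<q = *-cancelʳ-< a c q (subst₂ _<_ d≡ n≡q*a (diffMod<n (orbit t) y))
    n≡c*a+r : n ≡ c * a + r
    n≡c*a+r = begin
      n                     ≡⟨ n≡q*a ⟩
      q * a                 ≡⟨ cong (_* a) (m+[n∸m]≡n (<⇒≤ c<q)) ⟨
      (c + (q ∸ c)) * a     ≡⟨ *-distribʳ-+ a c (q ∸ c) ⟩
      c * a + (q ∸ c) * a   ∎
    regroup : ∀ x y z → x + (y + z) ≡ y + x + z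
    regroup = solve-∀

module _ {n S} .{{_ : NonZero n}} (gens : TwoGenerators n S) where
  open TwoGenerators gens
  open DifferenceGraph 0<a a<b b+b<n

  wheel⇒exceptional : ∀ {v m} → 3 ≤ m → SubgraphInComponent (Circulant n S) v (Wheel m) → Exceptional
  wheel⇒exceptional {m = suc (suc (suc m))} (s≤s (s≤s (s≤s _))) (f , f-injective , f-hom , _) =
    exceptional (three-branching⇒a⁺ g₀≢g₁ g₁≢g₂ g₀≢g₂ (branching i₀) (branching i₁) (branching i₂))
                (three-branching⇒b⁺ g₀≢g₁ g₁≢g₂ g₀≢g₂ (branching i₀) (branching i₁) (branching i₂))
    where
    open ≡-Reasoning
    adjacent⇔ : ∀ x y → Circulant n S x y ⇔ ∃ λ g → diffMod n x y ≡ ⟦ g ⟧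
    adjacent⇔ = circulant⇔ a∈S b∈S S⊆ab

    hub : Fin n
    hub = f zero

    rim : Fin (3 + m) → Fin n
    rim i = f (suc i)

    spoke : ∀ i → ∃ λ g → diffMod n (rim i) hub ≡ ⟦ g ⟧
    spoke i = Equivalence.to (adjacent⇔ (rim i) hub) (f-hom (suc i) zero tt)

    gen : Fin (3 + m) → Generator
    gen i = proj₁ (spoke i)

    gen-injective : ∀ {i j} → i ≢ j → gen i ≢ gen j
    gen-injective {i} {j} i≢j gi≡gj = i≢j (Finₚ.suc-injective (f-injective (diffMod-injectiveˡ hub (begin
      diffMod n (rim i) hub ≡⟨ proj₂ (spoke i) ⟩
      ⟦ gen i ⟧             ≡⟨ cong ⟦_⟧ gi≡gj ⟩
      ⟦ gen j ⟧             ≡⟨ proj₂ (spoke j) ⟨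
      diffMod n (rim j) hub ∎))))

    compatible : ∀ {i j} → Cycle (3 + m) j i → j ≢ i → Compatible (gen i) (gen j)
    compatible {i} {j} j~i j≢i
      with Equivalence.to (adjacent⇔ (rim j) (rim i)) (f-hom (suc j) (suc i) j~i)
    ... | e , rim-step = linked⇒compatible (gen i) {e} (gen-injective (j≢i ∘ sym)) (begin
      ⟦ gen j ⟧                                                ≡⟨ proj₂ (spoke j) ⟨
      diffMod n (rim j) hub                                    ≡⟨ diffMod-trans (rim j) (rim i) hub ⟩
      (diffMod n (rim j) (rim i) + diffMod n (rim i) hub) % n
        ≡⟨ cong₂ (λ x y → (x + y) % n) rim-step (proj₂ (spoke i)) ⟩
      (⟦ e ⟧ + ⟦ gen i ⟧) % n                                  ∎)

    branching : ∀ i → Branching (gen i)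
    branching i with cycle-neighbours i
    ... | j , l , j~i , l~i , j≢l , j≢i , l≢i =
      gen j , gen l , gen-injective j≢l , compatible j~i j≢i , compatible l~i l≢i

    i₀ i₁ i₂ : Fin (3 + m)
    i₀ = zero
    i₁ = suc zero
    i₂ = suc (suc zero)

    g₀≢g₁ : gen i₀ ≢ gen i₁
    g₀≢g₁ = gen-injective λ ()
    g₁≢g₂ : gen i₁ ≢ gen i₂
    g₁≢g₂ = gen-injective λ ()
    g₀≢g₂ : gen i₀ ≢ gen i₂
    g₀≢g₂ = gen-injective λ ()

  component≅C[1,2] : ∀ q .{{_ : NonZero q}} → n ≡ q * a → b ≡ 2 * a → ∀ v →
                     ComponentIso (Circulant n S) v (C[1,2] q)
  component≅C[1,2] q n≡q*a b≡2a v =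
    orbit ∘ toℕ , orbit-injective , reach ∘ toℕ , surjective ,
    (λ i j → Equivalence.to (orbit-adjacent⇔ i j)) , (λ i j → Equivalence.from (orbit-adjacent⇔ i j))
    where
    instance
      a≢0 : NonZero a
      a≢0 = >-nonZero 0<a
    open Orbit {n} {q} {a} n≡q*a v

    G : Graph (Fin n)
    G = Circulant n S

    scaled : ∀ g → residue n a b g ≡ residue q 1 2 g * a
    scaled = residue-scale {n} {q} n≡q*a b≡2a

    adjacent⇔ : ∀ x y → G x y ⇔ ∃ λ g → diffMod n x y ≡ residue n a b g
    adjacent⇔ = circulant⇔ a∈S b∈S S⊆ab

    adjacent-C[1,2]⇔ : ∀ i j → C[1,2] q i j ⇔ ∃ λ g → diffMod q i j ≡ residue q 1 2 g
    adjacent-C[1,2]⇔ = circulant⇔ (here refl) (there (here refl)) 1∨2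
      where
      1∨2 : ∀ {s} → s ∈ 1 ∷ 2 ∷ [] → s ≡ 1 ⊎ s ≡ 2
      1∨2 (here s≡1)         = inj₁ s≡1
      1∨2 (there (here s≡2)) = inj₂ s≡2

    orbit-adjacent⇔ : ∀ i j → C[1,2] q i j ⇔ G (orbit (toℕ i)) (orbit (toℕ j))
    orbit-adjacent⇔ i j = mk⇔
      (λ adj → let g , d≡ = Equivalence.to (adjacent-C[1,2]⇔ i j) adj in
        Equivalence.from (adjacent⇔ (orbit (toℕ i)) (orbit (toℕ j))) (g , trans (diffMod-orbit i j)
                                          (trans (cong (_* a) d≡) (sym (scaled g)))))
      (λ adj → let g , d≡ = Equivalence.to (adjacent⇔ (orbit (toℕ i)) (orbit (toℕ j))) adj in
        Equivalence.from (adjacent-C[1,2]⇔ i j) (g , *-cancelʳ-≡ _ _ a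
          (trans (sym (diffMod-orbit i j)) (trans d≡ (scaled g)))))

    reach : ∀ t → Reachable G v (orbit t)
    reach zero    = subst (Reachable G v) (sym orbit-zero) here
    reach (suc t) = reachable-snoc (reach t)
      (Equivalence.from (adjacent⇔ (orbit t) (orbit (suc t))) (a⁻ , orbit-step t))

    reachable⇒orbit : ∀ {x u} t → x ≡ orbit t → Reachable G x u → ∃ λ t′ → u ≡ orbit t′
    reachable⇒orbit t x≡ here = t , x≡
    reachable⇒orbit t refl (step {v = y} x~y y→u) with Equivalence.to (adjacent⇔ (orbit t) y) x~y
    ... | g , d≡ = reachable⇒orbit (t + (q ∸ residue q 1 2 g))
                     (orbit-closed t y {residue q 1 2 g} (trans d≡ (scaled g))) y→u

    surjective : ∀ u → Reachable G v u → ∃ λ i → orbit (toℕ i) ≡ u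
    surjective u v→u with reachable⇒orbit 0 (sym orbit-zero) v→u
    ... | t , u≡ = fromℕ< (m%n<n t q) ,
                   trans (cong orbit (toℕ-fromℕ< (m%n<n t q))) (trans (orbit-% t) (sym u≡))

  classify : ∀ v → ComponentWheelFree (Circulant n S) v
                   ⊎ ComponentIso (Circulant n S) v K5
                   ⊎ ComponentIso (Circulant n S) v SigmaC4
  classify v with exceptional?
  ... | yes (b≡2a , inj₁ n≡5a) = inj₂ (inj₁ (componentIso-≅ K5≅C[1,2] (component≅C[1,2] 5 n≡5a b≡2a v)))
  ... | yes (b≡2a , inj₂ n≡6a) = inj₂ (inj₂ (componentIso-≅ ΣC4≅C[1,2] (component≅C[1,2] 6 n≡6a b≡2a v)))
  ... | no ¬exceptional        = inj₁ λ m 3≤m wheel → ¬exceptional (wheel⇒exceptional 3≤m wheel)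

proposition4p3 : (n : ℕ) → 3 ≤ n → (S : List ℕ) → ValidConnSet n S
               → connSize n S ≡ 4
               → ∀ v → ComponentWheelFree (Circulant n S) v
                       ⊎ ComponentIso (Circulant n S) v K5
                       ⊎ ComponentIso (Circulant n S) v SigmaC4
proposition4p3 n@(suc _) _ S valid size = classify (twoGenerators valid size)
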